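{- Let $G=(A\cup B,E)$ be an instance of the popular matching problem, $\kappa$ a positive integer, and $G'$ the instance constructed as in the context. Let $M$ and $N$ be two matchings in $G$ and let $M'$ and $N'$ be the corresponding assignments in $G'$. Then $\Delta(N',M')=\sum_{a\in A}\mathsf{vote}^\kappa_a(N,M)$.
   Context: In $G$, each agent has a strict partial order over her neighbors; objects have no preferences. For matchings $N,M$ of $G$ and $a\in A$: $\mathsf{vote}^\kappa_a(N,M)=1$ if $a$ is matched in both and $N(a)\succ_aM(a)$; $-1$ if matched in both and $M(a)\succ_aN(a)$; $\kappa$ if matched in $N$ but not $M$; $-\kappa$ if matched in $M$ but not $N$; $0$ otherwise. For perfect matchings $N',M'$ of $G'$, $\Delta(N',M')$ is the number of agents $a$ with $N'(a)\succ_aM'(a)$ minus the number with $M'(a)\succ_aN'(a)$. Construction of $G'=(A'\cup B',E')$: $A'$ consists of $A$, a set $D$ of $|B|$ dummy agents, and new agents $p_1(a),\dots,p_{\kappa-1}(a)$ for each $a\in A$; $B'$ consists of $B$ and new objects $l_1(a),\dots,l_\kappa(a)$ for each $a\in A$. $E'$ consists of $E$, the edges of the path $(a,l_1(a),p_1(a),l_2(a),\dots,p_{\kappa-1}(a),l_\kappa(a))$ for each $a\in A$, and all edges between $D$ and $B\cup\{l_\kappa(a):a\in A\}$. Each $a\in A$ keeps her original preferences and ranks $l_1(a)$ strictly below all her original neighbors; $p_i(a)$ prefers $l_i(a)$ to $l_{i+1}(a)$; dummies are indifferent among their neighbors. The assignment $M'$ corresponding to a matching $M$ of $G$: for $a$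 matched in $M$, $M'(a)=M(a)$ and $M'(p_i(a))=l_i(a)$ for $i\in\{1,\dots,\kappa-1\}$; for $a$ unmatched in $M$, $M'(a)=l_1(a)$ and $M'(p_i(a))=l_{i+1}(a)$ for $i\in\{1,\dots,\kappa-1\}$; finally an arbitrary perfect matching between $D$ and the $|B|$ objects in $\{b\in B: b$ unmatched in $M\}\cup\{l_\kappa(a): a$ matched in $M\}$. -}

module Defs where

open import Data.Nat using (ℕ; zero; suc)
open import Data.Bool using (Bool; true; false; if_then_else_; _∧_)
open import Data.Fin using (Fin; zero; suc; inject₁; fromℕ; _≟_)
open import Data.Maybe using (Maybe; just; nothing)
open import Data.Product using (_×_; _,_; ∃)
open import Data.Integer using (ℤ; +_; -_; _-_; 0ℤ; 1ℤ)
open import Data.List using (List; []; _∷_; map; allFin; concatMap; _++_; filter; length; foldr)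
open import Relation.Nullary using (¬_; does)
open import Relation.Binary.PropositionalEquality using (_≡_)
open import Function using (_∘_)

-- Agents A = Fin nA, objects B = Fin nB, edges given by a Boolean
-- relation.  pref a b b' = true means  b ≻_a b'.

record Instance : Set where
  field
    nA nB  : ℕ
    edge   : Fin nA → Fin nB → Bool
    pref   : Fin nA → Fin nB → Fin nB → Bool
    pref-nbrs : ∀ a b b' → pref a b b' ≡ true → (edge a b ≡ true) × (edge a b' ≡ true)
    pref-irrefl : ∀ a b → pref a b b ≡ false
    pref-trans  : ∀ a b c d → pref a b c ≡ true → pref a c d ≡ true → pref a b d ≡ true

open Instance public

record Matching (G : Instance) : Set where
  field
    mate      : Fin (nA G) → Maybe (Fin (nB G))
    mate-edge : ∀ a b → mate a ≡ just b → edge G a b ≡ true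
    mate-inj  : ∀ a a' b → mate a ≡ just b → mate a' ≡ just b → a ≡ a'

open Matching public

vote : (G : Instance) (κ : ℕ) (a : Fin (nA G)) → Maybe (Fin (nB G)) → Maybe (Fin (nB G)) → ℤ
vote G κ a (just n) (just m) =
  if pref G a n m then 1ℤ else (if pref G a m n then - 1ℤ else 0ℤ)
vote G κ a (just n) nothing  = + κ
vote G κ a nothing  (just m) = - (+ κ)
vote G κ a nothing  nothing  = 0ℤ

sumℤ : List ℤ → ℤ
sumℤ = foldr Data.Integer._+_ 0ℤ

sumVotes : (G : Instance) (κ : ℕ) → Matching G → Matching G → ℤ
sumVotes G κ N M = sumℤ (map (λ a → vote G κ a (mate N a) (mate M a)) (allFin (nA G)))

-- The instance G' for κ = suc k.
-- Indexing: lo a i with i : Fin (suc k) is l_{i+1}(a);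
--           pp a j with j : Fin k       is p_{j+1}(a);
--           dum d with d : Fin nB       is the d-th dummy agent.

data Agent' (G : Instance) (k : ℕ) : Set where
  ag  : Fin (nA G) → Agent' G k
  dum : Fin (nB G) → Agent' G k
  pp  : Fin (nA G) → Fin k → Agent' G k

data Obj' (G : Instance) (k : ℕ) : Set where
  ob : Fin (nB G) → Obj' G k
  lo : Fin (nA G) → Fin (suc k) → Obj' G k

_==_ : ∀ {n} → Fin n → Fin n → Bool
i == j = does (i ≟ j)

edge' : (G : Instance) (k : ℕ) → Agent' G k → Obj' G k → Bool
edge' G k (ag a)   (ob b)    = edge G a b
edge' G k (ag a)   (lo a' i) = (a' == a) ∧ (i == zero)
edge' G k (pp a j) (ob b)    = false
edge' G k (pp a j) (lo a' i) = (a' == a) ∧ ((i == inject₁ j) Data.Bool.∨ (i == suc j))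
edge' G k (dum d)  (ob b)    = true
edge' G k (dum d)  (lo a i)  = i == fromℕ k

-- Preferences in G' (pref' x o o' = true means o ≻_x o').
-- a ∈ A keeps her preferences and ranks l_1(a) strictly below all her
-- original neighbours; p_i(a) prefers l_i(a) to l_{i+1}(a);
-- dummies are indifferent.
pref' : (G : Instance) (k : ℕ) → Agent' G k → Obj' G k → Obj' G k → Bool
pref' G k (ag a)   (ob b)    (ob b')   = pref G a b b'
pref' G k (ag a)   (ob b)    (lo a' i) = edge G a b ∧ ((a' == a) ∧ (i == zero))
pref' G k (ag a)   (lo _ _)  _         = false
pref' G k (pp a j) (lo a1 i1) (lo a2 i2) =
  (a1 == a) ∧ ((i1 == inject₁ j) ∧ ((a2 == a) ∧ (i2 == suc j)))
pref' G k (pp a j) _ _ = false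
pref' G k (dum d)  _ _ = false

allAgents' : (G : Instance) (k : ℕ) → List (Agent' G k)
allAgents' G k =
  map ag (allFin (nA G)) ++
  (map dum (allFin (nB G)) ++
   concatMap (λ a → map (pp a) (allFin k)) (allFin (nA G)))

Δ : (G : Instance) (k : ℕ) → (Agent' G k → Obj' G k) → (Agent' G k → Obj' G k) → ℤ
Δ G k N' M' =
  + length (filter (λ x → Data.Bool.T? (pref' G k x (N' x) (M' x))) (allAgents' G k))
  - + length (filter (λ x → Data.Bool.T? (pref' G k x (M' x) (N' x))) (allAgents' G k))

-- The assignment M' corresponding to M, given the (arbitrary) choice
-- dM of the perfect matching between the dummies D and the objects
-- {b ∈ B unmatched in M} ∪ {l_κ(a) : a matched in M}.

corr : (G : Instance) (k : ℕ) → Matching G → (Fin (nB G) → Obj' G k) → Agent' G k → Obj' G k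
corr G k M dM (ag a) with mate M a
... | just b  = ob b
... | nothing = lo a zero
corr G k M dM (pp a j) with mate M a
... | just _  = lo a (inject₁ j)
... | nothing = lo a (suc j)
corr G k M dM (dum d) = dM d

DummyTarget : (G : Instance) (k : ℕ) → Matching G → Obj' G k → Set
DummyTarget G k M (ob b)   = ¬ (∃ λ a → mate M a ≡ just b)
DummyTarget G k M (lo a i) = (i ≡ fromℕ k) × (∃ λ b → mate M a ≡ just b)

IsDummyPM : (G : Instance) (k : ℕ) (M : Matching G) → (Fin (nB G) → Obj' G k) → Set
IsDummyPM G k M dM =
  (∀ d → DummyTarget G k M (dM d)) ×
  ((∀ d d' → dM d ≡ dM d' → d ≡ d') ×
   (∀ o → DummyTarget G k M o → ∃ λ d → dM d ≡ o))

-- Split Δ(N', M') into the votes of the agents of G'.  Dummies never vote.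
-- The path agents p₁(a), …, p_{κ-1}(a) all vote alike: each prefers N' iff a
-- is matched in N but not in M, and M' in the reverse case.  So a together
-- with her path votes vote¹_a(N, M) + (κ - 1)·([a ∈ N] - [a ∈ M]), which is
-- vote^κ_a(N, M).
module Submission where

open import Defs
open import Data.Bool using (Bool; true; false; if_then_else_; T?)
open import Data.Fin using (Fin; zero; suc; inject₁; toℕ; _≟_)
open import Data.Fin.Properties using (toℕ-inject₁)
open import Data.Integer using (ℤ; +_; -_; _+_; _-_; _*_; 0ℤ; 1ℤ)
open import Data.Integer.Properties using (+-identityˡ; +-identityʳ; *-identityʳ; *-zeroʳ)
open import Data.Integer.Solver using (module +-*-Solver)
open import Data.List using (List; []; _∷_; map; allFin; concatMap; _++_; filter; length)
open import Data.List.Properties using (map-++; map-cong; map-∘; length-tabulate)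
open import Data.Maybe using (Maybe; just; nothing; is-just)
open import Data.Nat using (ℕ; suc)
open import Data.Nat.Properties using (1+n≢n)
open import Function using (_∘_)
open import Relation.Binary.PropositionalEquality
  using (_≡_; _≢_; refl; sym; trans; cong; cong₂; module ≡-Reasoning)
open import Relation.Nullary.Decidable using (dec-true; dec-false)

open +-*-Solver

indicator : Bool → ℤ
indicator true  = 1ℤ
indicator false = 0ℤ

sumℤ-++ : (xs ys : List ℤ) → sumℤ (xs ++ ys) ≡ sumℤ xs + sumℤ ys
sumℤ-++ []       ys = sym (+-identityˡ (sumℤ ys))
sumℤ-++ (x ∷ xs) ys rewrite sumℤ-++ xs ys =
  solve 3 (λ x s t → x :+ (s :+ t) := (x :+ s) :+ t) refl x (sumℤ xs) (sumℤ ys)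

sumℤ-map-− : {X : Set} (f g : X → ℤ) (xs : List X) →
  sumℤ (map f xs) - sumℤ (map g xs) ≡ sumℤ (map (λ x → f x - g x) xs)
sumℤ-map-− f g []       = refl
sumℤ-map-− f g (x ∷ xs) rewrite sym (sumℤ-map-− f g xs) =
  solve 4 (λ a b s t → (a :+ s) :- (b :+ t) := (a :- b) :+ (s :- t)) refl
    (f x) (g x) (sumℤ (map f xs)) (sumℤ (map g xs))

sumℤ-map-const : {X : Set} (c : ℤ) (xs : List X) →
  sumℤ (map (λ _ → c) xs) ≡ + length xs * c
sumℤ-map-const c []       = refl
sumℤ-map-const c (x ∷ xs) rewrite sumℤ-map-const c xs =
  solve 2 (λ c n → c :+ n :* c := (con 1ℤ :+ n) :* c) refl c (+ length xs)

sumℤ-map-+ : {X : Set} (f g : X → ℤ) (xs : List X) →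
  sumℤ (map f xs) + sumℤ (map g xs) ≡ sumℤ (map (λ x → f x + g x) xs)
sumℤ-map-+ f g []       = refl
sumℤ-map-+ f g (x ∷ xs) rewrite sym (sumℤ-map-+ f g xs) =
  solve 4 (λ a b s t → (a :+ s) :+ (b :+ t) := (a :+ b) :+ (s :+ t)) refl
    (f x) (g x) (sumℤ (map f xs)) (sumℤ (map g xs))

sumℤ-concatMap : {X Y : Set} (f : Y → ℤ) (g : X → List Y) (xs : List X) →
  sumℤ (map f (concatMap g xs)) ≡ sumℤ (map (λ x → sumℤ (map f (g x))) xs)
sumℤ-concatMap f g []       = refl
sumℤ-concatMap f g (x ∷ xs) = begin
  sumℤ (map f (g x ++ concatMap g xs))
    ≡⟨ cong sumℤ (map-++ f (g x) (concatMap g xs)) ⟩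
  sumℤ (map f (g x) ++ map f (concatMap g xs))
    ≡⟨ sumℤ-++ (map f (g x)) _ ⟩
  sumℤ (map f (g x)) + sumℤ (map f (concatMap g xs))
    ≡⟨ cong (_+_ (sumℤ (map f (g x)))) (sumℤ-concatMap f g xs) ⟩
  sumℤ (map f (g x)) + sumℤ (map (λ x → sumℤ (map f (g x))) xs) ∎
  where open ≡-Reasoning

count-as-sumℤ : {X : Set} (p : X → Bool) (xs : List X) →
  + length (filter (T? ∘ p) xs) ≡ sumℤ (map (indicator ∘ p) xs)
count-as-sumℤ p []       = refl
count-as-sumℤ p (x ∷ xs) with p x
... | true  = cong (_+_ 1ℤ) (count-as-sumℤ p xs)
... | false = trans (count-as-sumℤ p xs) (sym (+-identityˡ _))

indicator-− : ∀ p q → (p ≡ true → q ≡ false) →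
  indicator p - indicator q ≡ (if p then 1ℤ else (if q then - 1ℤ else 0ℤ))
indicator-− true  true  p⇒¬q with () ← p⇒¬q refl
indicator-− true  false _ = refl
indicator-− false true  _ = refl
indicator-− false false _ = refl

==-refl : ∀ {n} (i : Fin n) → (i == i) ≡ true
==-refl i = dec-true (i ≟ i) refl

inject₁≢suc : ∀ {n} (j : Fin n) → inject₁ j ≢ suc j
inject₁≢suc j eq = 1+n≢n (sym (trans (sym (toℕ-inject₁ j)) (cong toℕ eq)))

inject₁==suc : ∀ {n} (j : Fin n) → (inject₁ j == suc j) ≡ false
inject₁==suc j = dec-false (inject₁ j ≟ suc j) (inject₁≢suc j)

suc==inject₁ : ∀ {n} (j : Fin n) → (suc j == inject₁ j) ≡ false
suc==inject₁ j = dec-false (suc j ≟ inject₁ j) (inject₁≢suc j ∘ sym)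

module _ (G : Instance) where

  pref-asym : ∀ a b b' → pref G a b b' ≡ true → pref G a b' b ≡ false
  pref-asym a b b' b≻b' with pref G a b' b in b'≻b
  ... | false = refl
  ... | true  with () ← trans (sym (pref-trans G a b b' b b≻b' b'≻b)) (pref-irrefl G a b)

  matched-difference : Maybe (Fin (nB G)) → Maybe (Fin (nB G)) → ℤ
  matched-difference n m = indicator (is-just n) - indicator (is-just m)

  vote-suc : ∀ k a n m →
    vote G (suc k) a n m ≡ vote G 1 a n m + + k * matched-difference n m
  vote-suc k a (just n) (just m) =
    sym (trans (cong (_+_ (vote G 1 a (just n) (just m))) (*-zeroʳ (+ k))) (+-identityʳ _))
  vote-suc k a (just n) nothing  = cong (_+_ 1ℤ) (sym (*-identityʳ (+ k)))
  vote-suc k a nothing  (just m) =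
    solve 1 (λ x → :- (con 1ℤ :+ x) := :- con 1ℤ :+ x :* (:- con 1ℤ)) refl (+ k)
  vote-suc k a nothing  nothing  = sym (trans (+-identityˡ _) (*-zeroʳ (+ k)))

module _ (G : Instance) (k : ℕ) where

  vote′ : (Agent' G k → Obj' G k) → (Agent' G k → Obj' G k) → Agent' G k → ℤ
  vote′ N' M' x = indicator (pref' G k x (N' x) (M' x)) - indicator (pref' G k x (M' x) (N' x))

  Δ-as-sumℤ : ∀ N' M' → Δ G k N' M' ≡ sumℤ (map (vote′ N' M') (allAgents' G k))
  Δ-as-sumℤ N' M' = begin
    Δ G k N' M'
      ≡⟨ cong₂ _-_ (count-as-sumℤ (λ x → pref' G k x (N' x) (M' x)) (allAgents' G k))
                   (count-as-sumℤ (λ x → pref' G k x (M' x) (N' x)) (allAgents' G k)) ⟩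
    sumℤ (map (λ x → indicator (pref' G k x (N' x) (M' x))) (allAgents' G k))
      - sumℤ (map (λ x → indicator (pref' G k x (M' x) (N' x))) (allAgents' G k))
      ≡⟨ sumℤ-map-− _ _ (allAgents' G k) ⟩
    sumℤ (map (vote′ N' M') (allAgents' G k)) ∎
    where open ≡-Reasoning

  sumℤ-allAgents' : (f : Agent' G k → ℤ) → (∀ d → f (dum d) ≡ 0ℤ) →
    sumℤ (map f (allAgents' G k))
      ≡ sumℤ (map (λ a → f (ag a) + sumℤ (map (f ∘ pp a) (allFin k))) (allFin (nA G)))
  sumℤ-allAgents' f dummy-zero = begin
    sumℤ (map f (map ag as ++ (map dum ds ++ paths)))
      ≡⟨ cong sumℤ (trans (map-++ f (map ag as) _) (cong (map f (map ag as) ++_) (map-++ f (map dum ds) paths))) ⟩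
    sumℤ (map f (map ag as) ++ (map f (map dum ds) ++ map f paths))
      ≡⟨ trans (sumℤ-++ (map f (map ag as)) _) (cong (_+_ (sumℤ (map f (map ag as)))) (sumℤ-++ (map f (map dum ds)) _)) ⟩
    sumℤ (map f (map ag as)) + (sumℤ (map f (map dum ds)) + sumℤ (map f paths))
      ≡⟨ cong₂ (λ s t → s + (t + sumℤ (map f paths))) (cong sumℤ (sym (map-∘ as))) dummies-zero ⟩
    sumℤ (map (f ∘ ag) as) + (0ℤ + sumℤ (map f paths))
      ≡⟨ cong (_+_ (sumℤ (map (f ∘ ag) as))) (+-identityˡ _) ⟩
    sumℤ (map (f ∘ ag) as) + sumℤ (map f paths)
      ≡⟨ cong (_+_ (sumℤ (map (f ∘ ag) as))) (sumℤ-concatMap f (λ a → map (pp a) (allFin k)) as) ⟩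
    sumℤ (map (f ∘ ag) as) + sumℤ (map (λ a → sumℤ (map f (map (pp a) (allFin k)))) as)
      ≡⟨ sumℤ-map-+ (f ∘ ag) _ as ⟩
    sumℤ (map (λ a → f (ag a) + sumℤ (map f (map (pp a) (allFin k)))) as)
      ≡⟨ cong sumℤ (map-cong (λ a → cong (_+_ (f (ag a))) (cong sumℤ (sym (map-∘ (allFin k))))) as) ⟩
    sumℤ (map (λ a → f (ag a) + sumℤ (map (f ∘ pp a) (allFin k))) as) ∎
    where
    open ≡-Reasoning
    as : List (Fin (nA G))
    as = allFin (nA G)
    ds : List (Fin (nB G))
    ds = allFin (nB G)
    paths : List (Agent' G k)
    paths = concatMap (λ a → map (pp a) (allFin k)) as
    dummies-zero : sumℤ (map f (map dum ds)) ≡ 0ℤ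
    dummies-zero = trans (cong sumℤ (trans (sym (map-∘ ds)) (map-cong dummy-zero ds)))
                         (trans (sumℤ-map-const 0ℤ ds) (*-zeroʳ (+ length ds)))

module _ (G : Instance) (k : ℕ) (M N : Matching G) (dM dN : Fin (nB G) → Obj' G k) where

  private
    vote-G' : Agent' G k → ℤ
    vote-G' = vote′ G k (corr G k N dN) (corr G k M dM)

  vote-G'-ag : ∀ a → vote-G' (ag a) ≡ vote G 1 a (mate N a) (mate M a)
  vote-G'-ag a with mate N a in eN | mate M a in eM
  ... | just n  | just m  = indicator-− (pref G a n m) (pref G a m n) (pref-asym G a n m)
  ... | just n  | nothing rewrite mate-edge N a n eN | ==-refl a = refl
  ... | nothing | just m  rewrite mate-edge M a m eM | ==-refl a = refl
  ... | nothing | nothing = refl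

  vote-G'-pp : ∀ a j → vote-G' (pp a j) ≡ matched-difference G (mate N a) (mate M a)
  vote-G'-pp a j with mate N a | mate M a
  ... | just _  | just _  rewrite ==-refl a | ==-refl (inject₁ j) | inject₁==suc j = refl
  ... | just _  | nothing rewrite ==-refl a | ==-refl (inject₁ j) | ==-refl (suc j) | suc==inject₁ j = refl
  ... | nothing | just _  rewrite ==-refl a | ==-refl (inject₁ j) | ==-refl (suc j) | suc==inject₁ j = refl
  ... | nothing | nothing rewrite ==-refl a | suc==inject₁ j = refl

  vote-G'-with-path : ∀ a →
    vote-G' (ag a) + sumℤ (map (vote-G' ∘ pp a) (allFin k)) ≡ vote G (suc k) a (mate N a) (mate M a)
  vote-G'-with-path a = begin
    vote-G' (ag a) + sumℤ (map (vote-G' ∘ pp a) (allFin k))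
      ≡⟨ cong₂ _+_ (vote-G'-ag a) (cong sumℤ (map-cong (vote-G'-pp a) (allFin k))) ⟩
    vote G 1 a (mate N a) (mate M a) + sumℤ (map (λ _ → difference) (allFin k))
      ≡⟨ cong (_+_ (vote G 1 a (mate N a) (mate M a))) (sumℤ-map-const difference (allFin k)) ⟩
    vote G 1 a (mate N a) (mate M a) + + length (allFin k) * difference
      ≡⟨ cong (λ n → vote G 1 a (mate N a) (mate M a) + + n * difference) (length-tabulate {n = k} (λ j → j)) ⟩
    vote G 1 a (mate N a) (mate M a) + + k * difference
      ≡⟨ sym (vote-suc G k a (mate N a) (mate M a)) ⟩
    vote G (suc k) a (mate N a) (mate M a) ∎
    where
    open ≡-Reasoning
    difference : ℤ
    difference = matched-difference G (mate N a) (mate M a)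

-- The dummies' matchings are irrelevant: dummies are indifferent, so they never vote.
proposition2 : (G : Instance) (k : ℕ) (M N : Matching G)
    (dM dN : Fin (nB G) → Obj' G k) →
    IsDummyPM G k M dM → IsDummyPM G k N dN →
    Δ G k (corr G k N dN) (corr G k M dM) ≡ sumVotes G (suc k) N M
proposition2 G k M N dM dN _ _ = begin
  Δ G k N' M'
    ≡⟨ Δ-as-sumℤ G k N' M' ⟩
  sumℤ (map (vote′ G k N' M') (allAgents' G k))
    ≡⟨ sumℤ-allAgents' G k (vote′ G k N' M') (λ _ → refl) ⟩
  sumℤ (map (λ a → vote′ G k N' M' (ag a) + sumℤ (map (vote′ G k N' M' ∘ pp a) (allFin k))) (allFin (nA G)))
    ≡⟨ cong sumℤ (map-cong (vote-G'-with-path G k M N dM dN) (allFin (nA G))) ⟩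
  sumVotes G (suc k) N M ∎
  where
  open ≡-Reasoning
  N' M' : Agent' G k → Obj' G k
  N' = corr G k N dN
  M' = corr G k M dM
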